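{- Let $n=n_1+\cdots+n_r$ with $r\ge1$ and positive integers $n_i$, $N_0=0$, $N_i=n_1+\cdots+n_i$, $b_1,\dots,b_n$ positive integers, and $\Delta\subset\mathbb{R}^{n+1}$ the convex hull of $V_0,V_1,\dots,V_{n+r+1}$ as in the context. Let $\delta$ be any codimension $1$ face of $\Delta$ not containing the origin, and let $\Delta_\delta$ be the polytope generated by the origin and $\delta$. Then $\Delta_\delta$ has exactly $n+2$ vertices, namely $$V_0,\ V_{n+1},\ \text{the } n-k \text{ vertices of } \{V_1,\dots,V_n\}\setminus\{V_{i_1},\dots,V_{i_k}\},\ \text{and } V_{n+1+j_1},\dots,V_{n+1+j_k},$$ for some $0\le k\le r$, pairwise distinct $j_1,\dots,j_k\in\{1,\dots,r\}$, and indices $i_1,\dots,i_k$ with $N_{j_l-1}+1\le i_l\le N_{j_l}$ for $1\le l\le k$.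
   Context: $V_0=0$; $V_1,\dots,V_{n+1}$ are the standard basis vectors $e_1,\dots,e_{n+1}$ of $\mathbb{R}^{n+1}$; and for $1\le i\le r$, $V_{n+1+i}=e_{n+1}-\sum_{l=N_{i-1}+1}^{N_i}b_le_l$.
   Formalization: Stated over ℚ^(n+1) instead of ℝ^(n+1): points have rational coordinates, and the supporting hyperplanes cutting out δ and the functionals exposing vertices of $\Delta_\delta$ are rational. -}

module Defs where

open import Data.Nat as ℕ using (ℕ; zero; suc; _∸_)
open import Data.Fin using (Fin; zero; suc; toℕ)
open import Data.Integer using (+_)
open import Data.Rational using (ℚ; 0ℚ; 1ℚ; _+_; _*_; -_; _/_; _≤_; _<_)
open import Data.Product using (Σ; _×_; ∃)
open import Data.Sum using (_⊎_)
open import Data.Bool using (Bool; true; false; if_then_else_; _∧_)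
open import Relation.Nullary using (¬_)
open import Relation.Nullary.Decidable using (⌊_⌋)
open import Relation.Binary.PropositionalEquality using (_≡_)

ℕ→ℚ : ℕ → ℚ
ℕ→ℚ k = + k / 1

∑ : ∀ {m} → (Fin m → ℚ) → ℚ
∑ {zero} f = 0ℚ
∑ {suc m} f = f zero + ∑ (λ i → f (suc i))

-- points of ℚ^(d) ; coordinate with 0-based index c is e_(c+1)-coordinate
Point : ℕ → Set
Point d = Fin d → ℚ

origin : ∀ {d} → Point d
origin _ = 0ℚ

_≈ₚ_ : ∀ {d} → Point d → Point d → Set
x ≈ₚ y = ∀ c → x c ≡ y c

_·_ : ∀ {d} → Point d → Point d → ℚ
a · x = ∑ (λ c → a c * x c)

-- 0-based lookup of a finite family of naturals, 0 outside the range
at : ∀ {r} → (Fin r → ℕ) → ℕ → ℕ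
at {zero} f _ = 0
at {suc r} f zero = f zero
at {suc r} f (suc i) = at (λ j → f (suc j)) i

N : ∀ {r} → (Fin r → ℕ) → ℕ → ℕ
N ns zero = 0
N ns (suc i) = N ns i ℕ.+ at ns i

idx : ∀ {d} → Fin d → ℕ
idx c = suc (toℕ c)

-- The points V_m of ℝ^(n+1) (here ℚ^(n+1)), for m = 0,...,n+r+1:
--   V_0 = 0, V_m = e_m (1 ≤ m ≤ n+1),
--   V_(n+1+i) = e_(n+1) - Σ_{l = N_(i-1)+1}^{N_i} b_l e_l   (1 ≤ i ≤ r)
-- ns i = n_(i+1) (0-based family), b l = b_(l+1) (0-based family), n = N ns r.
Vcoord : ∀ {r} (ns : Fin r → ℕ) (b : Fin (N ns r) → ℕ) → ℕ → ℕ → ℚ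
Vcoord {r} ns b zero t = 0ℚ
Vcoord {r} ns b (suc m) t =
  if ⌊ suc m ℕ.≤? suc n ⌋
  then (if ⌊ t ℕ.≟ suc m ⌋ then 1ℚ else 0ℚ)
  else (if ⌊ t ℕ.≟ suc n ⌋ then 1ℚ
        else (if ⌊ suc (N ns (i ∸ 1)) ℕ.≤? t ⌋ ∧ ⌊ t ℕ.≤? N ns i ⌋
              then - ℕ→ℚ (at b (t ∸ 1)) else 0ℚ))
  where
  n = N ns r
  i = suc m ∸ suc n

V : ∀ {r} (ns : Fin r → ℕ) (b : Fin (N ns r) → ℕ) → ℕ → Point (suc (N ns r))
V ns b m c = Vcoord ns b m (idx c)

InConvFin : ∀ {d m} → (Fin m → Point d) → Point d → Set
InConvFin {d} {m} P x =
  Σ (Fin m → ℚ) λ w → (∀ j → 0ℚ ≤ w j) × (∑ w ≡ 1ℚ)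
    × (∀ c → ∑ (λ j → w j * P j c) ≡ x c)

InConv : ∀ {d} → (Point d → Set) → Point d → Set
InConv {d} S x =
  Σ ℕ λ m → Σ (Fin m → Point d) λ P → (∀ j → S (P j)) × InConvFin P x

InΔ : ∀ {r} (ns : Fin r → ℕ) (b : Fin (N ns r) → ℕ) → Point (suc (N ns r)) → Set
InΔ {r} ns b = InConvFin {m = suc (suc (N ns r ℕ.+ r))} (λ j → V ns b (toℕ j))

AffIndep : ∀ {d m} → (Fin m → Point d) → Set
AffIndep {d} {m} p =
  (μ : Fin m → ℚ) → ∑ μ ≡ 0ℚ → (∀ c → ∑ (λ j → μ j * p j c) ≡ 0ℚ) → ∀ j → μ j ≡ 0ℚ

Face : ∀ {d} → (Point d → Set) → Point d → ℚ → Point d → Set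
Face P a c x = P x × (a · x ≡ c)

Supporting : ∀ {d} → (Point d → Set) → Point d → ℚ → Set
Supporting P a c = (¬ (∀ k → a k ≡ 0ℚ)) × (∀ x → P x → a · x ≤ c)

-- the face of P cut out by (a,c) has codimension 1 in ambient dimension d = suc n:
-- it contains d = n+1 affinely independent points (it lies in a hyperplane, so
-- its dimension is exactly n = dim P - 1 when P is full dimensional)
Codim1Face : ∀ {n} → (Point (suc n) → Set) → Point (suc n) → ℚ → Set
Codim1Face {n} P a c =
  Supporting P a c ×
  Σ (Fin (suc n) → Point (suc n)) λ p → (∀ j → Face P a c (p j)) × AffIndep p

IsVertex : ∀ {d} → (Point d → Set) → Point d → Set
IsVertex {d} P x =
  P x × Σ (Point d) λ w → ∀ y → P y → ¬ (y ≈ₚ x) → w · y < w · x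

{-# OPTIONS --safe #-}
module Submission where

-- Write δ = Δ ∩ {x | a·x = c}. As 0 ∈ Δ but 0 ∉ δ, we have c > 0, and since δ contains n+1 affinely
-- independent points, a linear functional vanishing on every vertex of Δ that lies in δ is zero.
-- Call a coordinate k tight when a_k = c, i.e. when e_k ∈ δ. Applying this criterion to e_k, to
-- b_k′ e_k − b_k e_k′ and to a functional U built from the 1/b_k shows: e_(n+1) ∈ δ; every coordinate
-- of a block j with V_(n+1+j) ∉ δ is tight; and a block j with V_(n+1+j) ∈ δ has exactly one coordinate
-- i_j that is not tight (at least one, since otherwise a·V_(n+1+j) < c).
-- As δ is the convex hull of the vertices of Δ it contains, Δ_δ = conv({0} ∪ δ) is the convex hull of
-- 0 and these vertices, and each of them is the unique maximiser among them of an explicit functional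
-- (−a, U, e_k or −e_(i_j)). So these are exactly the vertices of Δ_δ, and they form the list of the
-- statement, with j_1, …, j_k the blocks j such that V_(n+1+j) ∈ δ.

open import Defs
open import Data.Fin as Fin using (Fin; toℕ; punchIn; punchOut)
import Data.Fin.Properties as Fin
open import Data.Product using (Σ; _×_; _,_; proj₁; proj₂; ∃)
import Data.Product as Product
open import Data.Sum using (_⊎_; inj₁; inj₂)
import Data.Sum as Sum
open import Data.Empty using (⊥; ⊥-elim)
open import Data.Vec.Functional using (insertAt; _∷_)
open import Data.Vec.Functional.Properties using (insertAt-lookup; insertAt-punchIn)
open import Function using (_∘_; id)
open import Relation.Nullary using (¬_; ¬?; yes; no; Dec)
open import Relation.Nullary.Decidable using (⌊_⌋; decidable-stable; _×-dec_)
open import Data.Bool using (if_then_else_; _∧_)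
open import Relation.Binary.PropositionalEquality
  using (_≡_; _≢_; refl; sym; trans; cong; cong₂; subst; subst₂; module ≡-Reasoning)
open import Relation.Binary.Definitions using (tri<; tri≈; tri>)
open import Relation.Unary using (Decidable)
open import Function.Definitions using (Injective)
open import Data.Nat using (ℕ; zero; suc)
open import Data.Rational using (ℚ)
import Data.Nat as ℕ
import Data.Nat.Properties as ℕ
open import Algebra.Bundles using (CommutativeRing)

-- The arithmetic of ℚ is opened only inside this anonymous module, so that _+_ and _≤_ in the
-- statement at the end of the file are those of ℕ.
module _ where
  open import Data.Rational using (0ℚ; 1ℚ; _+_; _-_; _*_; -_; 1/_; _≤_; _<_; NonZero)
  import Data.Rational as ℚ
  import Data.Rational.Properties as ℚ
  open import Data.Rational.Solver using (module +-*-Solver)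
  open import Algebra.Properties.Semiring.Sum (CommutativeRing.semiring ℚ.+-*-commutativeRing)
    using (sum; sum-remove; ∑-distrib-+; *-distribˡ-sum; *-distribʳ-sum)
  open +-*-Solver
  open ≡-Reasoning

  *≡0⇒≡0⊎≡0 : ∀ x y → x * y ≡ 0ℚ → x ≡ 0ℚ ⊎ y ≡ 0ℚ
  *≡0⇒≡0⊎≡0 x y xy≡0 with x ℚ.≟ 0ℚ
  ... | yes x≡0 = inj₁ x≡0
  ... | no x≢0 = inj₂ (begin
      y               ≡⟨ ℚ.*-identityˡ y ⟨
      1ℚ * y          ≡⟨ cong (_* y) (ℚ.*-inverseˡ x) ⟨
      (1/ x * x) * y  ≡⟨ ℚ.*-assoc (1/ x) x y ⟩
      1/ x * (x * y)  ≡⟨ cong (1/ x *_) xy≡0 ⟩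
      1/ x * 0ℚ       ≡⟨ ℚ.*-zeroʳ (1/ x) ⟩
      0ℚ              ∎)
    where instance _ = ℚ.≢-nonZero x≢0

  0<1 : 0ℚ < 1ℚ
  0<1 = ℚ.positive⁻¹ 1ℚ

  ≡0⇒*-cong : ∀ {w x y} → w ≡ 0ℚ → w * x ≡ w * y
  ≡0⇒*-cong {x = x} {y} refl = trans (ℚ.*-zeroˡ x) (sym (ℚ.*-zeroˡ y))

  ≤∧≢⇒< : ∀ {x y} → x ≤ y → x ≢ y → x < y
  ≤∧≢⇒< {x} {y} x≤y x≢y with ℚ.<-cmp x y
  ... | tri< x<y _ _ = x<y
  ... | tri≈ _ x≡y _ = ⊥-elim (x≢y x≡y)
  ... | tri> _ _ y<x = ⊥-elim (ℚ.<-irrefl refl (ℚ.≤-<-trans x≤y y<x))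

  ∑≗sum : ∀ {m} (f : Fin m → ℚ) → ∑ f ≡ sum f
  ∑≗sum {zero} f = refl
  ∑≗sum {suc m} f = cong (f Fin.zero +_) (∑≗sum (f ∘ Fin.suc))

  ∑-cong : ∀ {m} {f g : Fin m → ℚ} → (∀ i → f i ≡ g i) → ∑ f ≡ ∑ g
  ∑-cong {zero} f≗g = refl
  ∑-cong {suc m} f≗g = cong₂ _+_ (f≗g Fin.zero) (∑-cong (f≗g ∘ Fin.suc))

  ∑-zero : ∀ {m} {f : Fin m → ℚ} → (∀ i → f i ≡ 0ℚ) → ∑ f ≡ 0ℚ
  ∑-zero {zero} f≗0 = refl
  ∑-zero {suc m} f≗0 = cong₂ _+_ (f≗0 Fin.zero) (∑-zero (f≗0 ∘ Fin.suc))

  ∑-+ : ∀ {m} (f g : Fin m → ℚ) → ∑ (λ i → f i + g i) ≡ ∑ f + ∑ g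
  ∑-+ f g = begin
    ∑ (λ i → f i + g i)    ≡⟨ ∑≗sum (λ i → f i + g i) ⟩
    sum (λ i → f i + g i)  ≡⟨ ∑-distrib-+ f g ⟩
    sum f + sum g          ≡⟨ cong₂ _+_ (∑≗sum f) (∑≗sum g) ⟨
    ∑ f + ∑ g              ∎

  ∑-*ˡ : ∀ {m} k (f : Fin m → ℚ) → ∑ (λ i → k * f i) ≡ k * ∑ f
  ∑-*ˡ k f = begin
    ∑ (λ i → k * f i)    ≡⟨ ∑≗sum (λ i → k * f i) ⟩
    sum (λ i → k * f i)  ≡⟨ *-distribˡ-sum k f ⟨
    k * sum f            ≡⟨ cong (k *_) (∑≗sum f) ⟨
    k * ∑ f              ∎

  ∑-*ʳ : ∀ {m} k (f : Fin m → ℚ) → ∑ (λ i → f i * k) ≡ ∑ f * k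
  ∑-*ʳ k f = begin
    ∑ (λ i → f i * k)    ≡⟨ ∑≗sum (λ i → f i * k) ⟩
    sum (λ i → f i * k)  ≡⟨ *-distribʳ-sum k f ⟨
    sum f * k            ≡⟨ cong (_* k) (∑≗sum f) ⟨
    ∑ f * k              ∎

  ∑-neg : ∀ {m} (f : Fin m → ℚ) → ∑ (λ i → - f i) ≡ - ∑ f
  ∑-neg {zero} f = refl
  ∑-neg {suc m} f =
    trans (cong (- f Fin.zero +_) (∑-neg (f ∘ Fin.suc))) (sym (ℚ.neg-distrib-+ (f Fin.zero) _))

  ∑-comm : ∀ {m n} (f : Fin m → Fin n → ℚ) →
           ∑ (λ i → ∑ (f i)) ≡ ∑ (λ j → ∑ (λ i → f i j))
  ∑-comm {zero} {n} f = sym (∑-zero {n} (λ _ → refl))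
  ∑-comm {suc m} f =
    trans (cong (∑ (f Fin.zero) +_) (∑-comm (f ∘ Fin.suc))) (sym (∑-+ (f Fin.zero) _))

  ∑-remove : ∀ {m} (f : Fin (suc m) → ℚ) k → ∑ f ≡ f k + ∑ (f ∘ punchIn k)
  ∑-remove f k = begin
    ∑ f                      ≡⟨ ∑≗sum f ⟩
    sum f                    ≡⟨ sum-remove {i = k} f ⟩
    f k + sum (f ∘ punchIn k) ≡⟨ cong (f k +_) (∑≗sum (f ∘ punchIn k)) ⟨
    f k + ∑ (f ∘ punchIn k)   ∎

  ∑-single : ∀ {m} (f : Fin m → ℚ) k → (∀ i → i ≢ k → f i ≡ 0ℚ) → ∑ f ≡ f k
  ∑-single {suc m} f k f≗0 = begin
    ∑ f                      ≡⟨ ∑-remove f k ⟩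
    f k + ∑ (f ∘ punchIn k)  ≡⟨ cong (f k +_) (∑-zero (λ i → f≗0 _ (Fin.punchInᵢ≢i k i))) ⟩
    f k + 0ℚ                 ≡⟨ ℚ.+-identityʳ (f k) ⟩
    f k                      ∎

  ∑-two : ∀ {m} (f : Fin m → ℚ) {k k′} → k ≢ k′ → (∀ i → i ≢ k → i ≢ k′ → f i ≡ 0ℚ) →
          ∑ f ≡ f k + f k′
  ∑-two {suc m} f {k} {k′} k≢k′ f≗0 = begin
    ∑ f                      ≡⟨ ∑-remove f k ⟩
    f k + ∑ (f ∘ punchIn k)  ≡⟨ cong (f k +_) (∑-single (f ∘ punchIn k) j rest≗0) ⟩
    f k + f (punchIn k j)    ≡⟨ cong (λ i → f k + f i) (Fin.punchIn-punchOut k≢k′) ⟩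
    f k + f k′               ∎
    where
    j = punchOut k≢k′
    rest≗0 : ∀ i → i ≢ j → f (punchIn k i) ≡ 0ℚ
    rest≗0 i i≢j = f≗0 _ (Fin.punchInᵢ≢i k i) λ eq →
      i≢j (Fin.punchIn-injective k i j (trans eq (sym (Fin.punchIn-punchOut k≢k′))))

  ∑-mono-≤ : ∀ {m} {f g : Fin m → ℚ} → (∀ i → f i ≤ g i) → ∑ f ≤ ∑ g
  ∑-mono-≤ {zero} f≤g = ℚ.≤-refl
  ∑-mono-≤ {suc m} f≤g = ℚ.+-mono-≤ (f≤g Fin.zero) (∑-mono-≤ (f≤g ∘ Fin.suc))

  ∑-mono-< : ∀ {m} {f g : Fin m → ℚ} → (∀ i → f i ≤ g i) → ∀ k → f k < g k → ∑ f < ∑ g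
  ∑-mono-< {suc m} {f} {g} f≤g k fk<gk =
    subst₂ _<_ (sym (∑-remove f k)) (sym (∑-remove g k))
      (ℚ.+-mono-<-≤ fk<gk (∑-mono-≤ (f≤g ∘ punchIn k)))

  ·-comm : ∀ {d} (u x : Point d) → u · x ≡ x · u
  ·-comm u x = ∑-cong (λ c → ℚ.*-comm (u c) (x c))

  ·-cong : ∀ {d} (u : Point d) {x y} → x ≈ₚ y → u · x ≡ u · y
  ·-cong u x≈y = ∑-cong (λ c → cong (u c *_) (x≈y c))

  ·-origin : ∀ {d} (u : Point d) → u · origin ≡ 0ℚ
  ·-origin u = ∑-zero (λ c → ℚ.*-zeroʳ (u c))

  ·-negˡ : ∀ {d} (u x : Point d) → (λ c → - u c) · x ≡ - (u · x)
  ·-negˡ u x = trans (∑-cong (λ c → sym (ℚ.neg-distribˡ-* (u c) (x c)))) (∑-neg (λ c → u c * x c))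

  ·-linearˡ : ∀ {d} α β (u v x : Point d) →
              (λ c → α * u c + β * v c) · x ≡ α * (u · x) + β * (v · x)
  ·-linearˡ α β u v x = begin
    ∑ (λ c → (α * u c + β * v c) * x c)
      ≡⟨ ∑-cong (λ c → distrib (u c) (v c) (x c)) ⟩
    ∑ (λ c → α * (u c * x c) + β * (v c * x c))
      ≡⟨ ∑-+ (λ c → α * (u c * x c)) (λ c → β * (v c * x c)) ⟩
    ∑ (λ c → α * (u c * x c)) + ∑ (λ c → β * (v c * x c))
      ≡⟨ cong₂ _+_ (∑-*ˡ α (λ c → u c * x c)) (∑-*ˡ β (λ c → v c * x c)) ⟩
    α * (u · x) + β * (v · x) ∎
    where
    distrib : ∀ u v x → (α * u + β * v) * x ≡ α * (u * x) + β * (v * x)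
    distrib u v x =
      solve 5 (λ α β u v x → (α :* u :+ β :* v) :* x := α :* (u :* x) :+ β :* (v :* x)) refl α β u v x

  ·-supported : ∀ {d} (u x : Point d) k → (∀ c → c ≢ k → u c ≡ 0ℚ) → u · x ≡ u k * x k
  ·-supported u x k u≗0 = ∑-single _ k (λ c c≢k → trans (cong (_* x c) (u≗0 c c≢k)) (ℚ.*-zeroˡ (x c)))

  ·-combination : ∀ {d m} (u : Point d) (w : Fin m → ℚ) (P : Fin m → Point d) {y} →
                  (∀ c → ∑ (λ j → w j * P j c) ≡ y c) → u · y ≡ ∑ (λ j → w j * (u · P j))
  ·-combination u w P {y} y≡∑wP = begin
    ∑ (λ c → u c * y c)
      ≡⟨ ∑-cong (λ c → cong (u c *_) (sym (y≡∑wP c))) ⟩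
    ∑ (λ c → u c * ∑ (λ j → w j * P j c))
      ≡⟨ ∑-cong (λ c → sym (∑-*ˡ (u c) (λ j → w j * P j c))) ⟩
    ∑ (λ c → ∑ (λ j → u c * (w j * P j c)))
      ≡⟨ ∑-comm (λ c j → u c * (w j * P j c)) ⟩
    ∑ (λ j → ∑ (λ c → u c * (w j * P j c)))
      ≡⟨ ∑-cong (λ j → trans (∑-cong (λ c → swap (u c) (w j) (P j c)))
                              (∑-*ˡ (w j) (λ c → u c * P j c))) ⟩
    ∑ (λ j → w j * (u · P j)) ∎
    where
    swap : ∀ x y z → x * (y * z) ≡ y * (x * z)
    swap = solve 3 (λ x y z → x :* (y :* z) := y :* (x :* z)) refl

  OnSupport : ∀ {m} → (Fin m → ℚ) → (Fin m → Set) → Set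
  OnSupport w P = ∀ i → w i ≡ 0ℚ ⊎ P i

  module _ {m} {w : Fin m → ℚ} (0≤w : ∀ i → 0ℚ ≤ w i) (∑w≡1 : ∑ w ≡ 1ℚ)
           {t : Fin m → ℚ} {T : ℚ} where

    private
      wt≤wT : OnSupport w (λ i → t i ≤ T) → ∀ i → w i * t i ≤ w i * T
      wt≤wT t≤T i with t≤T i
      ... | inj₁ wi≡0 = ℚ.≤-reflexive (≡0⇒*-cong wi≡0)
      ... | inj₂ ti≤T = ℚ.*-monoˡ-≤-nonNeg (w i) {{ℚ.nonNegative (0≤w i)}} ti≤T

      ∑wT≡T : ∑ (λ i → w i * T) ≡ T
      ∑wT≡T = trans (∑-*ʳ T w) (trans (cong (_* T) ∑w≡1) (ℚ.*-identityˡ T))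

    average≤ : OnSupport w (λ i → t i ≤ T) → ∑ (λ i → w i * t i) ≤ T
    average≤ t≤T = subst (_ ≤_) ∑wT≡T (∑-mono-≤ (wt≤wT t≤T))

    average≡⇒onSupport : OnSupport w (λ i → t i ≤ T) → ∑ (λ i → w i * t i) ≡ T →
                         OnSupport w (λ i → t i ≡ T)
    average≡⇒onSupport t≤T ∑wt≡T i with w i ℚ.≟ 0ℚ | t i ℚ.≟ T | t≤T i
    ... | yes wi≡0 | _        | _         = inj₁ wi≡0
    ... | no _     | yes ti≡T | _         = inj₂ ti≡T
    ... | no wi≢0  | no _     | inj₁ wi≡0 = inj₁ wi≡0
    ... | no wi≢0  | no ti≢T  | inj₂ ti≤T =
      ⊥-elim (ℚ.<-irrefl ∑wt≡T (subst (_ <_) ∑wT≡T (∑-mono-< (wt≤wT t≤T) i wti<wT)))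
      where
      wti<wT : w i * t i < w i * T
      wti<wT = ℚ.*-monoʳ-<-pos (w i) {{ℚ.positive (≤∧≢⇒< (0≤w i) (wi≢0 ∘ sym))}}
                               (≤∧≢⇒< ti≤T ti≢T)

  onSupport-zipWith : ∀ {m} {w : Fin m → ℚ} {P Q R : Fin m → Set} → (∀ j → P j → Q j → R j) →
                      OnSupport w P → OnSupport w Q → OnSupport w R
  onSupport-zipWith f P Q j with P j | Q j
  ... | inj₁ wj≡0 | _         = inj₁ wj≡0
  ... | inj₂ _    | inj₁ wj≡0 = inj₁ wj≡0
  ... | inj₂ p    | inj₂ q    = inj₂ (f j p q)

  onSupport-*-cong : ∀ {m} {w f g : Fin m → ℚ} → OnSupport w (λ j → f j ≡ g j) →
                     ∀ j → w j * f j ≡ w j * g j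
  onSupport-*-cong {w = w} f≡g j = Sum.[ ≡0⇒*-cong , cong (w j *_) ] (f≡g j)

  argmax : ∀ {m} (w t : Fin m → ℚ) →
           (∀ i → w i ≡ 0ℚ) ⊎ Σ (Fin m) λ j → w j ≢ 0ℚ × OnSupport w (λ i → t i ≤ t j)
  argmax {zero} w t = inj₁ λ ()
  argmax {suc m} w t with w Fin.zero ℚ.≟ 0ℚ | argmax (w ∘ Fin.suc) (t ∘ Fin.suc)
  ... | yes w₀≡0 | inj₁ w≗0 = inj₁ λ { Fin.zero → w₀≡0 ; (Fin.suc i) → w≗0 i }
  ... | yes w₀≡0 | inj₂ (j , wj≢0 , t≤tj) =
    inj₂ (Fin.suc j , wj≢0 , λ { Fin.zero → inj₁ w₀≡0 ; (Fin.suc i) → t≤tj i })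
  ... | no w₀≢0 | inj₁ w≗0 =
    inj₂ (Fin.zero , w₀≢0 , λ { Fin.zero → inj₂ ℚ.≤-refl ; (Fin.suc i) → inj₁ (w≗0 i) })
  ... | no w₀≢0 | inj₂ (j , wj≢0 , t≤tj) with t (Fin.suc j) ℚ.≤? t Fin.zero
  ...   | yes tj≤t₀ =
    inj₂ (Fin.zero , w₀≢0 , λ { Fin.zero → inj₂ ℚ.≤-refl
                              ; (Fin.suc i) → Sum.map₂ (λ ti≤tj → ℚ.≤-trans ti≤tj tj≤t₀) (t≤tj i) })
  ...   | no tj≰t₀ =
    inj₂ (Fin.suc j , wj≢0 , λ { Fin.zero → inj₂ (ℚ.<⇒≤ (ℚ.≰⇒> tj≰t₀))
                               ; (Fin.suc i) → t≤tj i })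

  average≤some : ∀ {m} {w : Fin m → ℚ} → (∀ i → 0ℚ ≤ w i) → ∑ w ≡ 1ℚ → (t : Fin m → ℚ) →
                 Σ (Fin m) λ j → w j ≢ 0ℚ × ∑ (λ i → w i * t i) ≤ t j
  average≤some 0≤w ∑w≡1 t with argmax _ t
  ... | inj₁ w≗0 = ⊥-elim (ℚ.1≢0 (trans (sym ∑w≡1) (∑-zero w≗0)))
  ... | inj₂ (j , wj≢0 , t≤tj) = j , wj≢0 , average≤ 0≤w ∑w≡1 t≤tj

  ·-combination≤some : ∀ {d m} {w : Fin m → ℚ} {P : Fin m → Point d} {y} →
    (∀ j → 0ℚ ≤ w j) → ∑ w ≡ 1ℚ → (∀ c → ∑ (λ j → w j * P j c) ≡ y c) →
    ∀ u → Σ (Fin m) λ j → w j ≢ 0ℚ × u · y ≤ u · P j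
  ·-combination≤some {w = w} {P} 0≤w ∑w≡1 y≡∑wP u =
    let j , wj≢0 , avg≤uPj = average≤some 0≤w ∑w≡1 (λ j → u · P j)
    in j , wj≢0 , subst (_≤ u · P j) (sym (·-combination u w P y≡∑wP)) avg≤uPj

  Below : ∀ {d} → Point d → Point d → Point d → Set
  Below u q x = u · x ≤ u · q × (u · x ≡ u · q → x ≈ₚ q)

  Below-combination : ∀ {d m} {u q : Point d} {w : Fin m → ℚ} {P : Fin m → Point d} {y} →
    (∀ j → 0ℚ ≤ w j) → ∑ w ≡ 1ℚ → (∀ c → ∑ (λ j → w j * P j c) ≡ y c) →
    OnSupport w (Below u q ∘ P) → Below u q y
  Below-combination {u = u} {q} {w} {P} {y} 0≤w ∑w≡1 y≡∑wP P-below = uy≤uq , y≈q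
    where
    uy≡ : u · y ≡ ∑ (λ j → w j * (u · P j))
    uy≡ = ·-combination u w P y≡∑wP
    uP≤uq : OnSupport w (λ j → u · P j ≤ u · q)
    uP≤uq = Sum.map₂ proj₁ ∘ P-below
    uy≤uq : u · y ≤ u · q
    uy≤uq = subst (_≤ u · q) (sym uy≡) (average≤ 0≤w ∑w≡1 {t = λ j → u · P j} uP≤uq)
    y≈q : u · y ≡ u · q → y ≈ₚ q
    y≈q uy≡uq c = begin
      y c                       ≡⟨ y≡∑wP c ⟨
      ∑ (λ j → w j * P j c)     ≡⟨ ∑-cong (onSupport-*-cong {w = w} {λ j → P j c} P≈q) ⟩
      ∑ (λ j → w j * q c)       ≡⟨ ∑-*ʳ (q c) w ⟩
      ∑ w * q c                 ≡⟨ cong (_* q c) ∑w≡1 ⟩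
      1ℚ * q c                  ≡⟨ ℚ.*-identityˡ (q c) ⟩
      q c                       ∎
      where
      uP≡uq : OnSupport w (λ j → u · P j ≡ u · q)
      uP≡uq = average≡⇒onSupport 0≤w ∑w≡1 {t = λ j → u · P j} uP≤uq (trans (sym uy≡) uy≡uq)
      P≈q : OnSupport w (λ j → P j c ≡ q c)
      P≈q = onSupport-zipWith (λ _ uPj≡uq Pj-below → proj₂ Pj-below uPj≡uq c) uP≡uq P-below

  ≈⊎<⇒Below : ∀ {d} {u q x : Point d} → x ≈ₚ q ⊎ u · x < u · q → Below u q x
  ≈⊎<⇒Below {u = u} (inj₁ x≈q) = ℚ.≤-reflexive (·-cong u x≈q) , λ _ → x≈q
  ≈⊎<⇒Below (inj₂ ux<uq) = ℚ.<⇒≤ ux<uq , λ ux≡uq → ⊥-elim (ℚ.<-irrefl ux≡uq ux<uq)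

  -- Linear dependence

  LinearlyDependent : ∀ {d m} → (Fin m → Point d) → Set
  LinearlyDependent {d} {m} v =
    Σ (Fin m → ℚ) λ μ → (Σ (Fin m) λ j → μ j ≢ 0ℚ) × (∀ c → ∑ (λ j → μ j * v j c) ≡ 0ℚ)

  -- Gaussian elimination: when the first column of the rows other than j₀ is r times that of row j₀,
  -- subtract r times row j₀, find a dependency μ′ among the reduced rows without their first column,
  -- and give row j₀ the coefficient −Σ μ′ r.
  dependent-elimination : ∀ {d} → (∀ (v : Fin (suc d) → Point d) → LinearlyDependent v) →
    ∀ (v : Fin (suc (suc d)) → Point (suc d)) j₀ (r : Fin (suc d) → ℚ) →
    (∀ i → v (punchIn j₀ i) Fin.zero ≡ r i * v j₀ Fin.zero) → LinearlyDependent v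
  dependent-elimination {d} ih v j₀ r pivotColumn = extend (ih (λ i c → reduced i (Fin.suc c)))
    where
    reduced : Fin (suc d) → Point (suc d)
    reduced i c = v (punchIn j₀ i) c - r i * v j₀ c

    reduced-pivotColumn : ∀ i → reduced i Fin.zero ≡ 0ℚ
    reduced-pivotColumn i =
      trans (cong (_- r i * v j₀ Fin.zero) (pivotColumn i)) (ℚ.+-inverseʳ (r i * v j₀ Fin.zero))

    extend : LinearlyDependent (λ i c → reduced i (Fin.suc c)) → LinearlyDependent v
    extend (μ′ , (i₀ , μ′i₀≢0) , μ′reduced≡0) = μ , (punchIn j₀ i₀ , μ≢0) , μv≡0
      where
      S = ∑ (λ i → μ′ i * r i)
      μ = insertAt μ′ j₀ (- S)

      μ≢0 : μ (punchIn j₀ i₀) ≢ 0ℚ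
      μ≢0 = subst (_≢ 0ℚ) (sym (insertAt-punchIn μ′ j₀ (- S) i₀)) μ′i₀≢0

      ∑μ′reduced≡0 : ∀ c → ∑ (λ i → μ′ i * reduced i c) ≡ 0ℚ
      ∑μ′reduced≡0 Fin.zero =
        ∑-zero (λ i → trans (cong (μ′ i *_) (reduced-pivotColumn i)) (ℚ.*-zeroʳ (μ′ i)))
      ∑μ′reduced≡0 (Fin.suc c) = μ′reduced≡0 c

      μv≡0 : ∀ c → ∑ (λ j → μ j * v j c) ≡ 0ℚ
      μv≡0 c = begin
        ∑ (λ j → μ j * v j c)
          ≡⟨ ∑-remove (λ j → μ j * v j c) j₀ ⟩
        μ j₀ * x + ∑ (λ i → μ (punchIn j₀ i) * v (punchIn j₀ i) c)
          ≡⟨ cong₂ _+_ (cong (_* x) (insertAt-lookup μ′ j₀ (- S)))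
                       (∑-cong (λ i → cong (_* v (punchIn j₀ i) c) (insertAt-punchIn μ′ j₀ (- S) i))) ⟩
        - S * x + ∑ (λ i → μ′ i * v (punchIn j₀ i) c)
          ≡⟨ cong (- S * x +_) (∑-cong (λ i → unreduce (μ′ i) (v (punchIn j₀ i) c) (r i))) ⟩
        - S * x + ∑ (λ i → μ′ i * reduced i c + μ′ i * r i * x)
          ≡⟨ cong (- S * x +_) (∑-+ (λ i → μ′ i * reduced i c) (λ i → μ′ i * r i * x)) ⟩
        - S * x + (∑ (λ i → μ′ i * reduced i c) + ∑ (λ i → μ′ i * r i * x))
          ≡⟨ cong₂ (λ a b → - S * x + (a + b)) (∑μ′reduced≡0 c) (∑-*ʳ x (λ i → μ′ i * r i)) ⟩
        - S * x + (0ℚ + S * x)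
          ≡⟨ solve 2 (λ S x → :- S :* x :+ (con 0ℚ :+ S :* x) := con 0ℚ) refl S x ⟩
        0ℚ ∎
        where
        x = v j₀ c
        unreduce : ∀ μ y r → μ * y ≡ μ * (y - r * x) + μ * r * x
        unreduce μ y r = solve 4 (λ μ y r x → μ :* y := μ :* (y :- r :* x) :+ μ :* r :* x) refl μ y r x

  dependent : ∀ d (v : Fin (suc d) → Point d) → LinearlyDependent v
  dependent zero v = (λ _ → 1ℚ) , (Fin.zero , ℚ.1≢0) , λ ()
  dependent (suc d) v with Fin.any? (λ j → ¬? (v j Fin.zero ℚ.≟ 0ℚ))
  ... | yes (j₀ , pivot≢0) =
    dependent-elimination (dependent d) v j₀ r (λ i → sym (cancel (v (punchIn j₀ i) Fin.zero)))
    where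
    p = v j₀ Fin.zero
    instance _ = ℚ.≢-nonZero pivot≢0
    r : Fin (suc d) → ℚ
    r i = v (punchIn j₀ i) Fin.zero * 1/ p
    cancel : ∀ a → a * 1/ p * p ≡ a
    cancel a = trans (ℚ.*-assoc a (1/ p) p) (trans (cong (a *_) (ℚ.*-inverseˡ p)) (ℚ.*-identityʳ a))
  ... | no no-pivot = dependent-elimination (dependent d) v Fin.zero (λ _ → 0ℚ) zeroColumn
    where
    zeroColumn : ∀ i → v (Fin.suc i) Fin.zero ≡ 0ℚ * v Fin.zero Fin.zero
    zeroColumn i =
      trans (decidable-stable (v (Fin.suc i) Fin.zero ℚ.≟ 0ℚ) (λ ≢0 → no-pivot (Fin.suc i , ≢0)))
            (sym (ℚ.*-zeroˡ (v Fin.zero Fin.zero)))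

  -- Drop coordinate k and take a dependency of the shortened vectors; coordinate k of the combination
  -- vanishes too, because u kills it and u k ≢ 0.
  dependent-inHyperplane : ∀ {n} (u : Point (suc n)) {k} → u k ≢ 0ℚ →
    (v : Fin (suc n) → Point (suc n)) → (∀ j → u · v j ≡ 0ℚ) → LinearlyDependent v
  dependent-inHyperplane {n} u {k} uk≢0 v uv≡0 = extend (dependent n (λ j c → v j (punchIn k c)))
    where
    extend : LinearlyDependent (λ j c → v j (punchIn k c)) → LinearlyDependent v
    extend (μ , μ≢0 , μv≡0) = μ , μ≢0 , s≡0
      where
      s : Point (suc n)
      s c = ∑ (λ j → μ j * v j c)

      uk*sk≡0 : u k * s k ≡ 0ℚ
      uk*sk≡0 = begin
        u k * s k                                                ≡⟨ ℚ.+-identityʳ (u k * s k) ⟨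
        u k * s k + 0ℚ                                           ≡⟨ cong (u k * s k +_) s⊥k≡0 ⟨
        u k * s k + ∑ (λ c → u (punchIn k c) * s (punchIn k c))  ≡⟨ ∑-remove (λ c → u c * s c) k ⟨
        u · s                                                    ≡⟨ ·-combination u μ v (λ c → refl) ⟩
        ∑ (λ j → μ j * (u · v j))                                ≡⟨ ∑-zero μuv≡0 ⟩
        0ℚ                                                       ∎
        where
        μuv≡0 : ∀ j → μ j * (u · v j) ≡ 0ℚ
        μuv≡0 j = trans (cong (μ j *_) (uv≡0 j)) (ℚ.*-zeroʳ (μ j))
        s⊥k≡0 : ∑ (λ c → u (punchIn k c) * s (punchIn k c)) ≡ 0ℚ
        s⊥k≡0 = ∑-zero (λ c → trans (cong (u (punchIn k c) *_) (μv≡0 c)) (ℚ.*-zeroʳ (u (punchIn k c))))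

      s≡0 : ∀ c → s c ≡ 0ℚ
      s≡0 c with c Fin.≟ k
      ... | yes refl = Sum.[ ⊥-elim ∘ uk≢0 , id ] (*≡0⇒≡0⊎≡0 (u k) (s k) uk*sk≡0)
      ... | no c≢k = subst (λ c → s c ≡ 0ℚ) (Fin.punchIn-punchOut k≢c) (μv≡0 (punchOut k≢c))
        where k≢c = c≢k ∘ sym

  -- A linear dependency Σ μ_j p_j = 0 gives c Σ μ_j = a · Σ μ_j p_j = 0, so it is an affine one.
  AffIndep-inHyperplane-spans : ∀ {n} {p : Fin (suc n) → Point (suc n)} {a c} → AffIndep p →
    (∀ j → a · p j ≡ c) → c ≢ 0ℚ → ∀ u → (∀ j → u · p j ≡ 0ℚ) → ∀ k → u k ≡ 0ℚ
  AffIndep-inHyperplane-spans {p = p} {a} {c} indep ap≡c c≢0 u up≡0 k =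
    decidable-stable (u k ℚ.≟ 0ℚ) λ uk≢0 → contradiction (dependent-inHyperplane u uk≢0 p up≡0)
    where
    contradiction : LinearlyDependent p → ⊥
    contradiction (μ , (j , μj≢0) , μp≡0) = μj≢0 (indep μ ∑μ≡0 μp≡0 j)
      where
      ∑μ*c≡0 : ∑ μ * c ≡ 0ℚ
      ∑μ*c≡0 = begin
        ∑ μ * c                            ≡⟨ ∑-*ʳ c μ ⟨
        ∑ (λ j → μ j * c)                  ≡⟨ ∑-cong (λ j → cong (μ j *_) (ap≡c j)) ⟨
        ∑ (λ j → μ j * (a · p j))          ≡⟨ ·-combination a μ p (λ _ → refl) ⟨
        a · (λ t → ∑ (λ j → μ j * p j t))  ≡⟨ trans (·-cong a μp≡0) (·-origin a) ⟩
        0ℚ                                 ∎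
      ∑μ≡0 : ∑ μ ≡ 0ℚ
      ∑μ≡0 = Sum.[ id , ⊥-elim ∘ c≢0 ] (*≡0⇒≡0⊎≡0 (∑ μ) c ∑μ*c≡0)

  -- Vertices of convex hulls

  ≈ₚ-sym : ∀ {d} {x y : Point d} → x ≈ₚ y → y ≈ₚ x
  ≈ₚ-sym x≈y c = sym (x≈y c)

  ≈ₚ-trans : ∀ {d} {x y z : Point d} → x ≈ₚ y → y ≈ₚ z → x ≈ₚ z
  ≈ₚ-trans x≈y y≈z c = trans (x≈y c) (y≈z c)

  _≈ₚ?_ : ∀ {d} (x y : Point d) → Dec (x ≈ₚ y)
  x ≈ₚ? y = Fin.all? (λ c → x c ℚ.≟ y c)

  CombinationOn : ∀ {d M} → (Fin M → Point d) → (Fin M → Set) → Point d → Set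
  CombinationOn {M = M} Q G y = Σ (Fin M → ℚ) λ ω →
    (∀ m → 0ℚ ≤ ω m) × ∑ ω ≡ 1ℚ × (∀ c → ∑ (λ m → ω m * Q m c) ≡ y c) × OnSupport ω G

  CombinationOn-member : ∀ {d m} (P : Fin m → Point d) j → CombinationOn P (_≡ j) (P j)
  CombinationOn-member {m = m} P j = δ , 0≤δ , trans (∑-single δ j δ-off) δ-diag , ∑δP≡Pj , δ-on
    where
    δ : Fin m → ℚ
    δ i = if ⌊ i Fin.≟ j ⌋ then 1ℚ else 0ℚ

    δ-diag : δ j ≡ 1ℚ
    δ-diag with j Fin.≟ j
    ... | yes _ = refl
    ... | no j≢j = ⊥-elim (j≢j refl)

    δ-off : ∀ i → i ≢ j → δ i ≡ 0ℚ
    δ-off i i≢j with i Fin.≟ j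
    ... | yes i≡j = ⊥-elim (i≢j i≡j)
    ... | no _ = refl

    0≤δ : ∀ i → 0ℚ ≤ δ i
    0≤δ i with i Fin.≟ j
    ... | yes _ = ℚ.nonNegative⁻¹ 1ℚ
    ... | no _ = ℚ.≤-refl

    ∑δP≡Pj : ∀ c → ∑ (λ i → δ i * P i c) ≡ P j c
    ∑δP≡Pj c = begin
      ∑ (λ i → δ i * P i c)  ≡⟨ ∑-single (λ i → δ i * P i c) j δP-off ⟩
      δ j * P j c            ≡⟨ cong (_* P j c) δ-diag ⟩
      1ℚ * P j c             ≡⟨ ℚ.*-identityˡ (P j c) ⟩
      P j c                  ∎
      where
      δP-off : ∀ i → i ≢ j → δ i * P i c ≡ 0ℚ
      δP-off i i≢j = trans (cong (_* P i c) (δ-off i i≢j)) (ℚ.*-zeroˡ (P i c))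

    δ-on : OnSupport δ (_≡ j)
    δ-on i with i Fin.≟ j
    ... | yes i≡j = inj₂ i≡j
    ... | no _ = inj₁ refl

  InConvFin-member : ∀ {d m} (P : Fin m → Point d) j → InConvFin P (P j)
  InConvFin-member P j =
    let ω , 0≤ω , ∑ω≡1 , ∑ωP≡Pj , _ = CombinationOn-member P j in ω , 0≤ω , ∑ω≡1 , ∑ωP≡Pj

  InConv-resp-≈ₚ : ∀ {d} {S : Point d → Set} {x y} → x ≈ₚ y → InConv S x → InConv S y
  InConv-resp-≈ₚ x≈y (k , P , SP , w , 0≤w , ∑w≡1 , x≡∑wP) =
    k , P , SP , w , 0≤w , ∑w≡1 , λ c → trans (x≡∑wP c) (x≈y c)

  InConv-singleton : ∀ {d} {S : Point d → Set} {x} → S x → InConv S x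
  InConv-singleton {x = x} Sx = 1 , (λ _ → x) , (λ _ → Sx) , InConvFin-member (λ _ → x) Fin.zero

  CombinationOn-⊥ : ∀ {d M} {Q : Fin M → Point d} {G : Fin M → Set} {u y} →
                    (∀ {m} → G m → u · Q m ≡ 0ℚ) → CombinationOn Q G y → u · y ≡ 0ℚ
  CombinationOn-⊥ {Q = Q} {u = u} u⊥Q (ω , _ , _ , y≡∑ωQ , G-on-ω) =
    trans (·-combination u ω Q y≡∑ωQ) (∑-zero λ m → trans (ωuQ≡ω0 m) (ℚ.*-zeroʳ (ω m)))
    where
    ωuQ≡ω0 : ∀ m → ω m * (u · Q m) ≡ ω m * 0ℚ
    ωuQ≡ω0 = onSupport-*-cong {w = ω} {g = λ _ → 0ℚ} (Sum.map₂ u⊥Q ∘ G-on-ω)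

  module HullOfCombinations {d M} (Q : Fin M → Point d) (G : Fin M → Set) (S : Point d → Set)
    (S⊆conv : ∀ {y} → S y → CombinationOn Q G y) (G⊆S : ∀ {m} → G m → S (Q m)) where

    CombinationOn-Below : ∀ {u q} → (∀ {m} → G m → Below u q (Q m)) →
                          ∀ {y} → CombinationOn Q G y → Below u q y
    CombinationOn-Below {u} {q} Q-below (ω , 0≤ω , ∑ω≡1 , y≡∑ωQ , G-on-ω) =
      Below-combination {u = u} {q} 0≤ω ∑ω≡1 y≡∑ωQ (Sum.map₂ Q-below ∘ G-on-ω)

    InConv-Below : ∀ {u q} → (∀ {m} → G m → Below u q (Q m)) → ∀ {y} → InConv S y → Below u q y
    InConv-Below {u} {q} Q-below (_ , P , SP , w , 0≤w , ∑w≡1 , y≡∑wP) =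
      Below-combination {u = u} {q} 0≤w ∑w≡1 y≡∑wP
        (λ j → inj₂ (CombinationOn-Below {u} {q} Q-below (S⊆conv (SP j))))

    CombinationOn-dominated : ∀ {y} → CombinationOn Q G y →
                              ∀ u → Σ (Fin M) λ m → G m × u · y ≤ u · Q m
    CombinationOn-dominated (ω , 0≤ω , ∑ω≡1 , y≡∑ωQ , G-on-ω) u =
      let m , ωm≢0 , uy≤uQm = ·-combination≤some 0≤ω ∑ω≡1 y≡∑ωQ u
      in m , Sum.[ ⊥-elim ∘ ωm≢0 , id ] (G-on-ω m) , uy≤uQm

    InConv-dominated : ∀ {y} → InConv S y → ∀ u → Σ (Fin M) λ m → G m × u · y ≤ u · Q m
    InConv-dominated (_ , P , SP , w , 0≤w , ∑w≡1 , y≡∑wP) u =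
      let j , _ , uy≤uPj = ·-combination≤some 0≤w ∑w≡1 y≡∑wP u
          m , Gm , uPj≤uQm = CombinationOn-dominated (S⊆conv (SP j)) u
      in m , Gm , ℚ.≤-trans uy≤uPj uPj≤uQm

    IsVertex⇒generator : ∀ {x} → IsVertex (InConv S) x → Σ (Fin M) λ m → G m × x ≈ₚ Q m
    IsVertex⇒generator {x} (x∈H , u , u-max) =
      let m , Gm , ux≤uQm = InConv-dominated x∈H u
          Qm∈H = InConv-singleton {S = S} (G⊆S Gm)
      in m , Gm , decidable-stable (x ≈ₚ? Q m) λ x≉Qm →
           ℚ.<-irrefl refl (ℚ.<-≤-trans (u-max (Q m) Qm∈H (x≉Qm ∘ ≈ₚ-sym)) ux≤uQm)

    generator⇒IsVertex : ∀ {m u} → G m → (∀ {m′} → G m′ → Below u (Q m) (Q m′)) →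
                         ∀ {x} → x ≈ₚ Q m → IsVertex (InConv S) x
    generator⇒IsVertex {m} {u} Gm Q-below {x} x≈Qm =
      InConv-resp-≈ₚ {S = S} (≈ₚ-sym x≈Qm) (InConv-singleton {S = S} (G⊆S Gm)) , u , u-max
      where
      u-max : ∀ y → InConv S y → ¬ (y ≈ₚ x) → u · y < u · x
      u-max y y∈H y≉x =
        let uy≤uQm , uy≡uQm⇒y≈Qm = InConv-Below {u} Q-below y∈H
        in subst (u · y <_) (·-cong u (≈ₚ-sym x≈Qm))
             (≤∧≢⇒< uy≤uQm (λ uy≡uQm → y≉x (≈ₚ-trans (uy≡uQm⇒y≈Qm uy≡uQm) (≈ₚ-sym x≈Qm))))

  record Enumeration {r} (P : Fin r → Set) : Set where
    field
      size : ℕ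
      size≤ : size ℕ.≤ r
      index : Fin size → Fin r
      index-injective : Injective _≡_ _≡_ index
      index-sound : ∀ l → P (index l)
      index-complete : ∀ {i} → P i → Σ (Fin size) λ l → index l ≡ i

  enumerate : ∀ {r} {P : Fin r → Set} → Decidable P → Enumeration P
  enumerate {zero} P? = record
    { size = 0 ; size≤ = ℕ.z≤n ; index = λ () ; index-injective = λ {} ; index-sound = λ ()
    ; index-complete = λ {i} _ → ⊥-elim (Fin.¬Fin0 i) }
  enumerate {suc r} {P} P? with P? Fin.zero
  ... | no ¬P₀ = record
    { size = size ; size≤ = ℕ.m≤n⇒m≤1+n size≤ ; index = Fin.suc ∘ index
    ; index-injective = index-injective ∘ Fin.suc-injective ; index-sound = index-sound
    ; index-complete = λ { {Fin.zero} P₀ → ⊥-elim (¬P₀ P₀)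
                         ; {Fin.suc i} Pi → Product.map₂ (cong Fin.suc) (index-complete Pi) } }
    where open Enumeration (enumerate (P? ∘ Fin.suc))
  ... | yes P₀ = record
    { size = suc size ; size≤ = ℕ.s≤s size≤ ; index = index′ ; index-injective = index′-injective
    ; index-sound = λ { Fin.zero → P₀ ; (Fin.suc l) → index-sound l }
    ; index-complete = λ { {Fin.zero} _ → Fin.zero , refl
                         ; {Fin.suc i} Pi → Product.map Fin.suc (cong Fin.suc) (index-complete Pi) } }
    where
    open Enumeration (enumerate (P? ∘ Fin.suc))
    index′ : Fin (suc size) → Fin (suc r)
    index′ = Fin.zero ∷ Fin.suc ∘ index
    index′-injective : Injective _≡_ _≡_ index′
    index′-injective {Fin.zero} {Fin.zero} _ = refl
    index′-injective {Fin.suc l} {Fin.suc l′} eq = cong Fin.suc (index-injective (Fin.suc-injective eq))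

  -- The polytope Δ

  if-yes : ∀ {P A : Set} (d : Dec P) {x y : A} → P → (if ⌊ d ⌋ then x else y) ≡ x
  if-yes (yes _) _ = refl
  if-yes (no ¬p) p = ⊥-elim (¬p p)

  if-no : ∀ {P A : Set} (d : Dec P) {x y : A} → ¬ P → (if ⌊ d ⌋ then x else y) ≡ y
  if-no (yes p) ¬p = ⊥-elim (¬p p)
  if-no (no _) _ = refl

  if-∧-yes : ∀ {P Q A : Set} (d : Dec P) (d′ : Dec Q) {x y : A} → P → Q →
             (if ⌊ d ⌋ ∧ ⌊ d′ ⌋ then x else y) ≡ x
  if-∧-yes (yes _) (yes _) _ _ = refl
  if-∧-yes (no ¬p) _ p _ = ⊥-elim (¬p p)
  if-∧-yes (yes _) (no ¬q) _ q = ⊥-elim (¬q q)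

  if-∧-no : ∀ {P Q A : Set} (d : Dec P) (d′ : Dec Q) {x y : A} → ¬ (P × Q) →
            (if ⌊ d ⌋ ∧ ⌊ d′ ⌋ then x else y) ≡ y
  if-∧-no (yes p) (yes q) ¬pq = ⊥-elim (¬pq (p , q))
  if-∧-no (no _) _ _ = refl
  if-∧-no (yes _) (no _) _ = refl

  at-toℕ : ∀ {m} (f : Fin m → ℕ) i → at f (toℕ i) ≡ f i
  at-toℕ f Fin.zero = refl
  at-toℕ f (Fin.suc i) = at-toℕ (f ∘ Fin.suc) i

  ℕ→ℚ-pos : ∀ {k} → 1 ℕ.≤ k → 0ℚ < ℕ→ℚ k
  ℕ→ℚ-pos {suc k} _ = ℚ.positive⁻¹ (ℕ→ℚ (suc k)) {{ℚ.normalize-pos (suc k) 1}}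

  -- Coordinates are 0-based: k : Fin (suc n) is the paper's coordinate k+1, so that e k = V_(k+1),
  -- last is coordinate n+1, blk i = V_(n+2+i), weight k = b_(k+1), and InBlock i t says that the
  -- 1-based coordinate t belongs to block i+1.
  module Polytope {r} (ns : Fin r → ℕ) (b : Fin (N ns r) → ℕ) where

    n : ℕ
    n = N ns r

    last : Fin (suc n)
    last = Fin.fromℕ n

    e : Fin (suc n) → Point (suc n)
    e k = V ns b (suc (toℕ k))

    blk : Fin r → Point (suc n)
    blk i = V ns b (suc n ℕ.+ suc (toℕ i))

    InBlock : Fin r → ℕ → Set
    InBlock i t = suc (N ns (toℕ i)) ℕ.≤ t × t ℕ.≤ N ns (suc (toℕ i))

    weight : Fin (suc n) → ℚ
    weight k = ℕ→ℚ (at b (toℕ k))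

    private
      V-unit : ∀ {m} t → m ℕ.≤ n → Vcoord ns b (suc m) t ≡ (if ⌊ t ℕ.≟ suc m ⌋ then 1ℚ else 0ℚ)
      V-unit {m} t m≤n with suc m ℕ.≤? suc n
      ... | yes _ = refl
      ... | no m≰n = ⊥-elim (m≰n (ℕ.s≤s m≤n))

      V-block : ∀ i t → Vcoord ns b (suc (n ℕ.+ suc i)) t ≡
        (if ⌊ t ℕ.≟ suc n ⌋ then 1ℚ
         else (if ⌊ suc (N ns i) ℕ.≤? t ⌋ ∧ ⌊ t ℕ.≤? N ns (suc i) ⌋
               then - ℕ→ℚ (at b (t ℕ.∸ 1)) else 0ℚ))
      V-block i t with suc (n ℕ.+ suc i) ℕ.≤? suc n
      ... | yes n+1+i≤n = ⊥-elim (ℕ.m+1+n≰m n (ℕ.s≤s⁻¹ n+1+i≤n))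
      ... | no _ rewrite ℕ.m+n∸m≡n n (suc i) = refl

    idx-injective : ∀ {c k : Fin (suc n)} → idx c ≡ idx k → c ≡ k
    idx-injective = Fin.toℕ-injective ∘ ℕ.suc-injective

    idx-last : idx last ≡ suc n
    idx-last = cong suc (Fin.toℕ-fromℕ n)

    idx≢1+n : ∀ {c} → c ≢ last → idx c ≢ suc n
    idx≢1+n c≢last c≡n = c≢last (idx-injective (trans c≡n (sym idx-last)))

    ≢last⇒toℕ<n : ∀ {c} → c ≢ last → toℕ c ℕ.< n
    ≢last⇒toℕ<n {c} c≢last = ℕ.≤∧≢⇒< (Fin.toℕ≤pred[n] c) (idx≢1+n c≢last ∘ cong suc)

    e-diag : ∀ k → e k k ≡ 1ℚ
    e-diag k = trans (V-unit (idx k) (Fin.toℕ≤pred[n] k)) (if-yes (idx k ℕ.≟ idx k) refl)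

    e-off : ∀ {k c} → c ≢ k → e k c ≡ 0ℚ
    e-off {k} {c} c≢k =
      trans (V-unit (idx c) (Fin.toℕ≤pred[n] k)) (if-no (idx c ℕ.≟ idx k) (c≢k ∘ idx-injective))

    ·-e : ∀ u k → u · e k ≡ u k
    ·-e u k = begin
      u · e k      ≡⟨ ·-comm u (e k) ⟩
      e k · u      ≡⟨ ·-supported (e k) u k (λ _ → e-off) ⟩
      e k k * u k  ≡⟨ cong (_* u k) (e-diag k) ⟩
      1ℚ * u k     ≡⟨ ℚ.*-identityˡ (u k) ⟩
      u k          ∎

    e-· : ∀ k x → e k · x ≡ x k
    e-· k x = trans (·-comm (e k) x) (·-e x k)

    N-mono : ∀ {i j} → i ℕ.≤ j → N ns i ℕ.≤ N ns j
    N-mono {j = zero} ℕ.z≤n = ℕ.z≤n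
    N-mono {i} {suc j} i≤1+j with ℕ.m≤n⇒m<n∨m≡n i≤1+j
    ... | inj₁ i<1+j = ℕ.≤-trans (N-mono (ℕ.s≤s⁻¹ i<1+j)) (ℕ.m≤m+n (N ns j) (at ns j))
    ... | inj₂ refl = ℕ.≤-refl

    InBlock? : ∀ i t → Dec (InBlock i t)
    InBlock? i t = (suc (N ns (toℕ i)) ℕ.≤? t) ×-dec (t ℕ.≤? N ns (suc (toℕ i)))

    InBlock⇒≢last : ∀ {i c} → InBlock i (idx c) → c ≢ last
    InBlock⇒≢last {i} (_ , c≤N) refl =
      ℕ.<-irrefl refl (ℕ.≤-trans (subst (ℕ._≤ N ns (suc (toℕ i))) idx-last c≤N) (N-mono (Fin.toℕ<n i)))

    InBlock-unique : ∀ {i i′ t} → InBlock i t → InBlock i′ t → i ≡ i′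
    InBlock-unique {i} {i′} (lo , hi) (lo′ , hi′) with ℕ.<-cmp (toℕ i) (toℕ i′)
    ... | tri< i<i′ _ _ = ⊥-elim (ℕ.<-irrefl refl (ℕ.≤-trans lo′ (ℕ.≤-trans hi (N-mono i<i′))))
    ... | tri≈ _ i≡i′ _ = Fin.toℕ-injective i≡i′
    ... | tri> _ _ i′<i = ⊥-elim (ℕ.<-irrefl refl (ℕ.≤-trans lo (ℕ.≤-trans hi′ (N-mono i′<i))))

    block-nonempty : (∀ i → 1 ℕ.≤ ns i) → ∀ i → Σ (Fin (suc n)) λ c → InBlock i (idx c)
    block-nonempty ns≥1 i =
      Fin.fromℕ< N<1+n , subst (λ t → InBlock i (suc t)) (sym (Fin.toℕ-fromℕ< N<1+n)) (ℕ.≤-refl , N<N′)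
      where
      N<N′ : N ns (toℕ i) ℕ.< N ns (suc (toℕ i))
      N<N′ = subst (ℕ._≤ N ns (suc (toℕ i))) (ℕ.+-comm (N ns (toℕ i)) 1)
               (ℕ.+-monoʳ-≤ (N ns (toℕ i)) (subst (1 ℕ.≤_) (sym (at-toℕ ns i)) (ns≥1 i)))
      N<1+n : N ns (toℕ i) ℕ.< suc n
      N<1+n = ℕ.s≤s (ℕ.≤-trans (ℕ.<⇒≤ N<N′) (N-mono (Fin.toℕ<n i)))

    ≢last⇒InBlock : ∀ {c} → c ≢ last → Σ (Fin r) λ i → InBlock i (idx c)
    ≢last⇒InBlock {c} c≢last = covered r ℕ.≤-refl (≢last⇒toℕ<n c≢last)
      where
      InBlock′ : ℕ → Set
      InBlock′ q = suc (N ns q) ℕ.≤ idx c × idx c ℕ.≤ N ns (suc q)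

      covered : ∀ q → q ℕ.≤ r → idx c ℕ.≤ N ns q → Σ (Fin r) λ i → InBlock i (idx c)
      covered zero _ ()
      covered (suc q) q<r c≤N with idx c ℕ.≤? N ns q
      ... | yes c≤N′ = covered q (ℕ.<⇒≤ q<r) c≤N′
      ... | no c≰N′ = Fin.fromℕ< q<r , subst InBlock′ (sym (Fin.toℕ-fromℕ< q<r)) (ℕ.≰⇒> c≰N′ , c≤N)

    blk-last : ∀ i → blk i last ≡ 1ℚ
    blk-last i = trans (V-block (toℕ i) (idx last)) (if-yes (idx last ℕ.≟ suc n) idx-last)

    blk-inBlock : ∀ {i c} → InBlock i (idx c) → blk i c ≡ - weight c
    blk-inBlock {i} {c} c∈i@(lo , hi) = begin
      blk i c     ≡⟨ V-block (toℕ i) (idx c) ⟩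
      _           ≡⟨ if-no (idx c ℕ.≟ suc n) (idx≢1+n (InBlock⇒≢last c∈i)) ⟩
      _           ≡⟨ if-∧-yes (suc (N ns (toℕ i)) ℕ.≤? idx c) (idx c ℕ.≤? N ns (suc (toℕ i))) lo hi ⟩
      - weight c  ∎

    blk-outside : ∀ {i c} → c ≢ last → ¬ InBlock i (idx c) → blk i c ≡ 0ℚ
    blk-outside {i} {c} c≢last c∉i = begin
      blk i c  ≡⟨ V-block (toℕ i) (idx c) ⟩
      _        ≡⟨ if-no (idx c ℕ.≟ suc n) (idx≢1+n c≢last) ⟩
      _        ≡⟨ if-∧-no (suc (N ns (toℕ i)) ℕ.≤? idx c) (idx c ℕ.≤? N ns (suc (toℕ i))) c∉i ⟩
      0ℚ       ∎

    blk-otherBlock : ∀ {i i′ k} → InBlock i (idx k) → i′ ≢ i → blk i′ k ≡ 0ℚ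
    blk-otherBlock k∈i i′≢i =
      blk-outside (InBlock⇒≢last k∈i) (λ k∈i′ → i′≢i (InBlock-unique k∈i′ k∈i))

    weight-pos : (∀ l → 1 ℕ.≤ b l) → ∀ {c} → c ≢ last → 0ℚ < weight c
    weight-pos b≥1 {c} c≢last = ℕ→ℚ-pos (subst (1 ℕ.≤_) (sym at-b≡b) (b≥1 (Fin.fromℕ< c<n)))
      where
      c<n = ≢last⇒toℕ<n c≢last
      at-b≡b : at b (toℕ c) ≡ b (Fin.fromℕ< c<n)
      at-b≡b = trans (cong (at b) (sym (Fin.toℕ-fromℕ< c<n))) (at-toℕ b (Fin.fromℕ< c<n))

    M : ℕ
    M = suc (suc (n ℕ.+ r))

    vertex : Fin M → Point (suc n)
    vertex m = V ns b (toℕ m)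

    V∈Δ : ∀ {m} → m ℕ.< M → InΔ ns b (V ns b m)
    V∈Δ m<M = subst (InΔ ns b) (cong (V ns b) (Fin.toℕ-fromℕ< m<M)) (InConvFin-member vertex (Fin.fromℕ< m<M))

    data VertexIndex : ℕ → Set where
      origin-index : VertexIndex 0
      unit-index : (k : Fin (suc n)) → VertexIndex (suc (toℕ k))
      block-index : (i : Fin r) → VertexIndex (suc n ℕ.+ suc (toℕ i))

    vertexIndex : ∀ {m} → m ℕ.< M → VertexIndex m
    vertexIndex {zero} _ = origin-index
    vertexIndex {suc m} 1+m<M with m ℕ.≤? n
    ... | yes m≤n =
      subst (VertexIndex ∘ suc) (Fin.toℕ-fromℕ< (ℕ.s≤s m≤n)) (unit-index (Fin.fromℕ< (ℕ.s≤s m≤n)))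
    ... | no m≰n = subst VertexIndex 1+n+1+i≡1+m (block-index (Fin.fromℕ< i<r))
      where
      1+n+i≡m : suc n ℕ.+ (m ℕ.∸ suc n) ≡ m
      1+n+i≡m = ℕ.m+[n∸m]≡n (ℕ.≰⇒> m≰n)
      i<r : m ℕ.∸ suc n ℕ.< r
      i<r = ℕ.+-cancelˡ-< (suc n) _ r (subst (ℕ._< suc n ℕ.+ r) (sym 1+n+i≡m) (ℕ.s≤s⁻¹ 1+m<M))
      1+n+1+i≡1+m : suc n ℕ.+ suc (toℕ (Fin.fromℕ< i<r)) ≡ suc m
      1+n+1+i≡1+m = begin
        suc n ℕ.+ suc (toℕ (Fin.fromℕ< i<r))  ≡⟨ cong (λ i → suc n ℕ.+ suc i) (Fin.toℕ-fromℕ< i<r) ⟩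
        suc n ℕ.+ suc (m ℕ.∸ suc n)           ≡⟨ ℕ.+-suc (suc n) _ ⟩
        suc (suc n ℕ.+ (m ℕ.∸ suc n))         ≡⟨ cong suc 1+n+i≡m ⟩
        suc m                                 ∎

    VertexIndex⇒< : ∀ {m} → VertexIndex m → m ℕ.< M
    VertexIndex⇒< origin-index = ℕ.z<s
    VertexIndex⇒< (unit-index k) = ℕ.s≤s (ℕ.s≤s (ℕ.≤-trans (Fin.toℕ≤pred[n] k) (ℕ.m≤m+n n r)))
    VertexIndex⇒< (block-index i) = ℕ.s≤s (ℕ.s≤s (ℕ.+-monoʳ-≤ n (Fin.toℕ<n i)))

  -- The facet δ and the polytope Δ_δ

  module Facet {r} (ns : Fin r → ℕ) (ns≥1 : ∀ i → 1 ℕ.≤ ns i)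
                  (b : Fin (N ns r) → ℕ) (b≥1 : ∀ l → 1 ℕ.≤ b l)
                  (a : Point (suc (N ns r))) (c : ℚ)
                  (δ-codim1 : Codim1Face (InΔ ns b) a c) (0∉δ : ¬ Face (InΔ ns b) a c origin) where

    open Polytope ns b

    δ : Point (suc n) → Set
    δ = Face (InΔ ns b) a c

    Tight : Fin (suc n) → Set
    Tight k = a k ≡ c

    TightBlock : Fin r → Set
    TightBlock i = a · blk i ≡ c

    Loose : Fin r → Fin (suc n) → Set
    Loose i k = InBlock i (idx k) × ¬ Tight k

    V-below : ∀ {m} → m ℕ.< M → a · V ns b m ≤ c
    V-below m<M = proj₂ (proj₁ δ-codim1) _ (V∈Δ m<M)

    0<c : 0ℚ < c
    0<c = ≤∧≢⇒< (subst (_≤ c) (·-origin a) (V-below ℕ.z<s))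
                λ 0≡c → 0∉δ (V∈Δ ℕ.z<s , trans (·-origin a) 0≡c)

    a≤c : ∀ k → a k ≤ c
    a≤c k = subst (_≤ c) (·-e a k) (V-below (VertexIndex⇒< (unit-index k)))

    δ⇒tightCombination : ∀ {y} → δ y → CombinationOn vertex (λ m → a · vertex m ≡ c) y
    δ⇒tightCombination ((ω , 0≤ω , ∑ω≡1 , y≡∑ωV) , ay≡c) =
      ω , 0≤ω , ∑ω≡1 , y≡∑ωV ,
      average≡⇒onSupport 0≤ω ∑ω≡1 {t = λ m → a · vertex m} (λ m → inj₂ (V-below (Fin.toℕ<n m)))
        (trans (sym (·-combination a ω vertex y≡∑ωV)) ay≡c)

    tightVertices-span : ∀ u → (∀ k → Tight k → u k ≡ 0ℚ) →
                         (∀ i → TightBlock i → u · blk i ≡ 0ℚ) → ∀ k → u k ≡ 0ℚ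
    tightVertices-span u u⊥e u⊥blk = spans (proj₂ δ-codim1)
      where
      u⊥V : ∀ {m} → VertexIndex m → a · V ns b m ≡ c → u · V ns b m ≡ 0ℚ
      u⊥V origin-index _ = ·-origin u
      u⊥V (unit-index k) ae≡c = trans (·-e u k) (u⊥e k (trans (sym (·-e a k)) ae≡c))
      u⊥V (block-index i) = u⊥blk i

      u⊥δ : ∀ {y} → δ y → u · y ≡ 0ℚ
      u⊥δ = CombinationOn-⊥ {Q = vertex} {u = u} (λ {m} → u⊥V (vertexIndex (Fin.toℕ<n m)))
          ∘ δ⇒tightCombination

      spans : (Σ (Fin (suc n) → Point (suc n)) λ p → (∀ j → δ (p j)) × AffIndep p) → ∀ k → u k ≡ 0ℚ
      spans (p , p∈δ , p-indep) =
        AffIndep-inHyperplane-spans {p = p} {a = a} p-indep (proj₂ ∘ p∈δ) (λ c≡0 → ℚ.<-irrefl (sym c≡0) 0<c)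
                                    u (u⊥δ ∘ p∈δ)

    e⊥tight : ∀ {k} → ¬ Tight k → ∀ k′ → Tight k′ → e k k′ ≡ 0ℚ
    e⊥tight k-loose k′ k′-tight = e-off (λ k′≡k → k-loose (subst Tight k′≡k k′-tight))

    ¬TightBlock⇒tight : ∀ {i k} → ¬ TightBlock i → InBlock i (idx k) → Tight k
    ¬TightBlock⇒tight {i} {k} i-loose k∈i = decidable-stable (a k ℚ.≟ c) λ k-loose →
      ℚ.1≢0 (trans (sym (e-diag k)) (tightVertices-span (e k) (e⊥tight k-loose) e⊥blk k))
      where
      e⊥blk : ∀ i′ → TightBlock i′ → e k · blk i′ ≡ 0ℚ
      e⊥blk i′ i′-tight =
        trans (e-· k (blk i′)) (blk-otherBlock k∈i λ i′≡i → i-loose (subst TightBlock i′≡i i′-tight))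

    loose-unique : ∀ {i k k′} → Loose i k → Loose i k′ → k ≡ k′
    loose-unique {i} {k} {k′} (k∈i , k-loose) (k′∈i , k′-loose) = decidable-stable (k Fin.≟ k′) λ k≢k′ →
      ℚ.<-irrefl (sym (trans (sym (u-at k≢k′)) (tightVertices-span u u⊥tight u⊥blk k)))
                 (weight-pos b≥1 (InBlock⇒≢last k′∈i))
      where
      w = weight k
      w′ = weight k′
      u : Point (suc n)
      u l = w′ * e k l + - w * e k′ l

      u-at : k ≢ k′ → u k ≡ w′
      u-at k≢k′ = trans (cong₂ (λ x y → w′ * x + - w * y) (e-diag k) (e-off k≢k′))
                        (solve 2 (λ w w′ → w′ :* con 1ℚ :+ :- w :* con 0ℚ := w′) refl w w′)

      u⊥tight : ∀ l → Tight l → u l ≡ 0ℚ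
      u⊥tight l l-tight =
        trans (cong₂ (λ x y → w′ * x + - w * y) (e⊥tight k-loose l l-tight) (e⊥tight k′-loose l l-tight))
              (solve 2 (λ w w′ → w′ :* con 0ℚ :+ :- w :* con 0ℚ := con 0ℚ) refl w w′)

      u⊥blk : ∀ i′ → TightBlock i′ → u · blk i′ ≡ 0ℚ
      u⊥blk i′ _ = cases (i′ Fin.≟ i)
        where
        cases : Dec (i′ ≡ i) → u · blk i′ ≡ 0ℚ
        cases (yes refl) = begin
          u · blk i
            ≡⟨ ·-linearˡ w′ (- w) (e k) (e k′) (blk i) ⟩
          w′ * (e k · blk i) + - w * (e k′ · blk i)
            ≡⟨ cong₂ (λ x y → w′ * x + - w * y) (trans (e-· k (blk i)) (blk-inBlock k∈i))
                                                 (trans (e-· k′ (blk i)) (blk-inBlock k′∈i)) ⟩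
          w′ * - w + - w * - w′
            ≡⟨ solve 2 (λ w w′ → w′ :* :- w :+ :- w :* :- w′ := con 0ℚ) refl w w′ ⟩
          0ℚ ∎
        cases (no i′≢i) = begin
          u · blk i′
            ≡⟨ ·-linearˡ w′ (- w) (e k) (e k′) (blk i′) ⟩
          w′ * (e k · blk i′) + - w * (e k′ · blk i′)
            ≡⟨ cong₂ (λ x y → w′ * x + - w * y) (trans (e-· k (blk i′)) (blk-otherBlock k∈i i′≢i))
                                                 (trans (e-· k′ (blk i′)) (blk-otherBlock k′∈i i′≢i)) ⟩
          w′ * 0ℚ + - w * 0ℚ
            ≡⟨ solve 2 (λ w w′ → w′ :* con 0ℚ :+ :- w :* con 0ℚ := con 0ℚ) refl w w′ ⟩
          0ℚ ∎

    -w<0 : ∀ {l} → l ≢ last → - weight l < 0ℚ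
    -w<0 l≢last = ℚ.neg-antimono-< (weight-pos b≥1 l≢last)

    all-tight⇒blk<c : ∀ {i} → (∀ {k} → InBlock i (idx k) → Tight k) → a · blk i < c
    all-tight⇒blk<c {i} tight =
      ℚ.<-≤-trans (∑-mono-< below-e-last L (strict L∈i)) (subst (_≤ c) (sym (·-e a last)) (a≤c last))
      where
      L = proj₁ (block-nonempty ns≥1 i)
      L∈i = proj₂ (block-nonempty ns≥1 i)

      strict : ∀ {l} → InBlock i (idx l) → a l * blk i l < a l * e last l
      strict {l} l∈i = subst₂ _<_ (sym (cong₂ _*_ (tight l∈i) (blk-inBlock l∈i))) c*0≡a*e
                                  (ℚ.*-monoʳ-<-pos c {{ℚ.positive 0<c}} (-w<0 l≢last))
        where
        l≢last = InBlock⇒≢last l∈i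
        c*0≡a*e : c * 0ℚ ≡ a l * e last l
        c*0≡a*e = sym (cong₂ _*_ (tight l∈i) (e-off l≢last))

      below-e-last : ∀ l → a l * blk i l ≤ a l * e last l
      below-e-last l = cases (l Fin.≟ last) (InBlock? i (idx l))
        where
        cases : Dec (l ≡ last) → Dec (InBlock i (idx l)) → a l * blk i l ≤ a l * e last l
        cases (yes refl) _ = ℚ.≤-reflexive (cong (a last *_) (trans (blk-last i) (sym (e-diag last))))
        cases (no _) (yes l∈i) = ℚ.<⇒≤ (strict l∈i)
        cases (no l≢last) (no l∉i) =
          ℚ.≤-reflexive (cong (a l *_) (trans (blk-outside l≢last l∉i) (sym (e-off l≢last))))

    TightBlock⇒loose : ∀ {i} → TightBlock i → Σ (Fin (suc n)) (Loose i)
    TightBlock⇒loose {i} i-tight = search (Fin.any? (λ k → InBlock? i (idx k) ×-dec ¬? (a k ℚ.≟ c)))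
      where
      search : Dec (∃ (Loose i)) → Σ (Fin (suc n)) (Loose i)
      search (yes found) = found
      search (no none) = ⊥-elim (ℚ.<-irrefl i-tight (all-tight⇒blk<c tight))
        where
        tight : ∀ {k} → InBlock i (idx k) → Tight k
        tight {k} k∈i = decidable-stable (a k ℚ.≟ c) λ k-loose → none (k , k∈i , k-loose)

    weight-nonZero : ∀ {l} → l ≢ last → NonZero (weight l)
    weight-nonZero {l} l≢last = ℚ.pos⇒nonZero (weight l) {{ℚ.positive (weight-pos b≥1 l≢last)}}

    -- U is 1 at the last coordinate, 0 at the other tight ones and 1/b_l at the remaining ones, so on
    -- each V_(n+1+j) ∈ δ the last coordinate and the unique non-tight one contribute 1 − 1 = 0.
    U-at : ∀ l → Dec (l ≡ last) → Dec (Tight l) → ℚ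
    U-at l (yes _)      _       = 1ℚ
    U-at l (no _)       (yes _) = 0ℚ
    U-at l (no l≢last)  (no _)  = (1/ weight l) {{weight-nonZero l≢last}}

    U : Point (suc n)
    U l = U-at l (l Fin.≟ last) (a l ℚ.≟ c)

    U-last : U last ≡ 1ℚ
    U-last = at-last (last Fin.≟ last) (a last ℚ.≟ c)
      where
      at-last : ∀ d t → U-at last d t ≡ 1ℚ
      at-last (yes _) _ = refl
      at-last (no last≢last) _ = ⊥-elim (last≢last refl)

    U-tight : ∀ {l} → l ≢ last → Tight l → U l ≡ 0ℚ
    U-tight {l} l≢last l-tight = at-tight (l Fin.≟ last) (a l ℚ.≟ c)
      where
      at-tight : ∀ d t → U-at l d t ≡ 0ℚ
      at-tight (yes l≡last) _ = ⊥-elim (l≢last l≡last)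
      at-tight (no _) (yes _) = refl
      at-tight (no _) (no l-loose) = ⊥-elim (l-loose l-tight)

    U-loose : ∀ {l} → l ≢ last → ¬ Tight l → U l * weight l ≡ 1ℚ
    U-loose {l} l≢last l-loose = at-loose (l Fin.≟ last) (a l ℚ.≟ c)
      where
      at-loose : ∀ d t → U-at l d t * weight l ≡ 1ℚ
      at-loose (yes l≡last) _ = ⊥-elim (l≢last l≡last)
      at-loose (no _) (yes l-tight) = ⊥-elim (l-loose l-tight)
      at-loose (no l≢last′) (no _) = ℚ.*-inverseˡ (weight l) {{weight-nonZero l≢last′}}

    U⊥TightBlock : ∀ {i} → TightBlock i → U · blk i ≡ 0ℚ
    U⊥TightBlock {i} i-tight = begin
      U · blk i
        ≡⟨ ∑-two (λ l → U l * blk i l) (λ last≡L → InBlock⇒≢last L∈i (sym last≡L)) others≡0 ⟩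
      U last * blk i last + U L * blk i L
        ≡⟨ cong₂ (λ x y → x * blk i last + U L * y) U-last (blk-inBlock L∈i) ⟩
      1ℚ * blk i last + U L * - weight L
        ≡⟨ cong₂ (λ x y → 1ℚ * x + y) (blk-last i) (sym (ℚ.neg-distribʳ-* (U L) (weight L))) ⟩
      1ℚ * 1ℚ + - (U L * weight L)
        ≡⟨ cong (λ x → 1ℚ * 1ℚ + - x) (U-loose (InBlock⇒≢last L∈i) L-loose) ⟩
      1ℚ * 1ℚ + - 1ℚ
        ≡⟨⟩
      0ℚ ∎
      where
      L = proj₁ (TightBlock⇒loose i-tight)
      L∈i = proj₁ (proj₂ (TightBlock⇒loose i-tight))
      L-loose = proj₂ (proj₂ (TightBlock⇒loose i-tight))

      others≡0 : ∀ l → l ≢ last → l ≢ L → U l * blk i l ≡ 0ℚ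
      others≡0 l l≢last l≢L = cases (InBlock? i (idx l))
        where
        cases : Dec (InBlock i (idx l)) → U l * blk i l ≡ 0ℚ
        cases (yes l∈i) = trans (cong (_* blk i l) (U-tight l≢last l-tight)) (ℚ.*-zeroˡ (blk i l))
          where
          l-tight : Tight l
          l-tight = decidable-stable (a l ℚ.≟ c) λ l-loose → l≢L (loose-unique (l∈i , l-loose) (L∈i , L-loose))
        cases (no l∉i) = trans (cong (U l *_) (blk-outside l≢last l∉i)) (ℚ.*-zeroʳ (U l))

    last-tight : Tight last
    last-tight = decidable-stable (a last ℚ.≟ c) λ last-loose →
      ℚ.1≢0 (trans (sym U-last) (tightVertices-span U (U⊥tight last-loose) (λ _ → U⊥TightBlock) last))
      where
      U⊥tight : ¬ Tight last → ∀ l → Tight l → U l ≡ 0ℚ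
      U⊥tight last-loose l l-tight = U-tight (λ l≡last → last-loose (subst Tight l≡last l-tight)) l-tight

    Generator : ℕ → Set
    Generator m = m ≡ 0 ⊎ a · V ns b m ≡ c

    Δδ : Point (suc n) → Set
    Δδ y = y ≈ₚ origin ⊎ δ y

    Δδ⊆conv : ∀ {y} → Δδ y → CombinationOn vertex (Generator ∘ toℕ) y
    Δδ⊆conv (inj₁ y≈0) =
      let ω , 0≤ω , ∑ω≡1 , ∑ωV≡0 , 0-on-ω = CombinationOn-member vertex Fin.zero
      in ω , 0≤ω , ∑ω≡1 , (λ k → trans (∑ωV≡0 k) (sym (y≈0 k))) ,
         Sum.map₂ (λ { refl → inj₁ refl }) ∘ 0-on-ω
    Δδ⊆conv (inj₂ y∈δ) =
      let ω , 0≤ω , ∑ω≡1 , y≡∑ωV , tight-on-ω = δ⇒tightCombination y∈δ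
      in ω , 0≤ω , ∑ω≡1 , y≡∑ωV , Sum.map₂ inj₂ ∘ tight-on-ω

    generator∈Δδ : ∀ {m} → Generator (toℕ m) → Δδ (vertex m)
    generator∈Δδ (inj₁ m≡0) = inj₁ (λ k → cong (λ t → V ns b t k) m≡0)
    generator∈Δδ {m} (inj₂ tight) = inj₂ (InConvFin-member vertex m , tight)

    open HullOfCombinations vertex (Generator ∘ toℕ) Δδ Δδ⊆conv generator∈Δδ

    Separates : Point (suc n) → ℕ → Set
    Separates u m = ∀ {m′} → VertexIndex m′ → Generator m′ →
                    V ns b m′ ≈ₚ V ns b m ⊎ u · V ns b m′ < u · V ns b m

    separated⇒vertex : ∀ {m} → m ℕ.< M → Generator m → ∀ u → Separates u m →
                       ∀ {x} → x ≈ₚ V ns b m → IsVertex (InConv Δδ) x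
    separated⇒vertex {m} m<M Gm u u-separates {x} x≈Vm =
      generator⇒IsVertex {Fin.fromℕ< m<M} {u} (subst Generator (sym eq) Gm) below
                         (subst (λ t → x ≈ₚ V ns b t) (sym eq) x≈Vm)
      where
      eq = Fin.toℕ-fromℕ< m<M
      below : ∀ {m′} → Generator (toℕ m′) → Below u (vertex (Fin.fromℕ< m<M)) (vertex m′)
      below {m′} Gm′ = subst (λ t → Below u (V ns b t) (vertex m′)) (sym eq)
                             (≈⊎<⇒Below {u = u} (u-separates (vertexIndex (Fin.toℕ<n m′)) Gm′))

    unit-generator⇒tight : ∀ {k} → Generator (suc (toℕ k)) → Tight k
    unit-generator⇒tight {k} (inj₂ ae≡c) = trans (sym (·-e a k)) ae≡c

    block-generator⇒tight : ∀ {i} → Generator (suc n ℕ.+ suc (toℕ i)) → TightBlock i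
    block-generator⇒tight (inj₂ i-tight) = i-tight

    origin-separates : Separates (λ k → - a k) 0
    origin-separates _ (inj₁ refl) = inj₁ (λ _ → refl)
    origin-separates {m′} _ (inj₂ aV≡c) =
      inj₂ (subst₂ _<_ (sym (trans (·-negˡ a (V ns b m′)) (cong -_ aV≡c)))
                       (sym (trans (·-negˡ a (V ns b 0)) (cong -_ (·-origin a))))
                       (ℚ.neg-antimono-< 0<c))

    ek·ek≡1 : ∀ k → e k · e k ≡ 1ℚ
    ek·ek≡1 k = trans (e-· k (e k)) (e-diag k)

    e-separates : ∀ {k} → k ≢ last → Separates (e k) (suc (toℕ k))
    e-separates {k} _ origin-index _ = inj₂ (subst₂ _<_ (sym (·-origin (e k))) (sym (ek·ek≡1 k)) 0<1)
    e-separates {k} _ (unit-index k′) _ = compare (k′ Fin.≟ k)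
      where
      compare : Dec (k′ ≡ k) → e k′ ≈ₚ e k ⊎ e k · e k′ < e k · e k
      compare (yes refl) = inj₁ (λ _ → refl)
      compare (no k′≢k) =
        inj₂ (subst₂ _<_ (sym (trans (e-· k (e k′)) (e-off (k′≢k ∘ sym)))) (sym (ek·ek≡1 k)) 0<1)
    e-separates {k} k≢last (block-index i) _ =
      inj₂ (subst₂ _<_ (sym (e-· k (blk i))) (sym (ek·ek≡1 k)) (blk<1 (InBlock? i (idx k))))
      where
      blk<1 : Dec (InBlock i (idx k)) → blk i k < 1ℚ
      blk<1 (yes k∈i) = subst (_< 1ℚ) (sym (blk-inBlock k∈i)) (ℚ.<-trans (-w<0 k≢last) 0<1)
      blk<1 (no k∉i) = subst (_< 1ℚ) (sym (blk-outside k≢last k∉i)) 0<1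

    U-separates : Separates U (suc (toℕ last))
    U-separates origin-index _ = inj₂ (subst₂ _<_ (sym (·-origin U)) (sym (trans (·-e U last) U-last)) 0<1)
    U-separates (unit-index k′) Gk′ = compare (k′ Fin.≟ last)
      where
      compare : Dec (k′ ≡ last) → e k′ ≈ₚ e last ⊎ U · e k′ < U · e last
      compare (yes refl) = inj₁ (λ _ → refl)
      compare (no k′≢last) =
        inj₂ (subst₂ _<_ (sym (trans (·-e U k′) (U-tight k′≢last (unit-generator⇒tight Gk′))))
                         (sym (trans (·-e U last) U-last)) 0<1)
    U-separates (block-index i) Gi =
      inj₂ (subst₂ _<_ (sym (U⊥TightBlock (block-generator⇒tight Gi))) (sym (trans (·-e U last) U-last)) 0<1)

    -e-· : ∀ L x → (λ l → - e L l) · x ≡ - x L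
    -e-· L x = trans (·-negˡ (e L) x) (cong -_ (e-· L x))

    blk-separates : ∀ {j L} → Loose j L → Separates (λ l → - e L l) (suc n ℕ.+ suc (toℕ j))
    blk-separates {j} {L} (L∈j , L-loose) = separates
      where
      0<top : 0ℚ < (λ l → - e L l) · blk j
      0<top = subst (0ℚ <_) (sym (trans (-e-· L (blk j)) (trans (cong -_ (blk-inBlock L∈j)) neg-neg)))
                    (weight-pos b≥1 (InBlock⇒≢last L∈j))
        where
        neg-neg : - - weight L ≡ weight L
        neg-neg = solve 1 (λ x → :- (:- x) := x) refl (weight L)
      below : ∀ {y} → y L ≡ 0ℚ → (λ l → - e L l) · y < (λ l → - e L l) · blk j
      below {y} yL≡0 = subst (_< _) (sym (trans (-e-· L y) (cong -_ yL≡0))) 0<top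

      separates : Separates (λ l → - e L l) (suc n ℕ.+ suc (toℕ j))
      separates origin-index _ = inj₂ (below {origin} refl)
      separates (unit-index k′) Gk′ =
        inj₂ (below {e k′} (e-off λ L≡k′ → L-loose (subst Tight (sym L≡k′) (unit-generator⇒tight Gk′))))
      separates (block-index i) _ = compare (i Fin.≟ j)
        where
        compare : Dec (i ≡ j) → blk i ≈ₚ blk j ⊎ (λ l → - e L l) · blk i < (λ l → - e L l) · blk j
        compare (yes refl) = inj₁ (λ _ → refl)
        compare (no i≢j) = inj₂ (below {blk i} (blk-otherBlock L∈j i≢j))

    open Enumeration (enumerate (λ i → a · blk i ℚ.≟ c)) public
      renaming (size to #tightBlocks; index to tightBlock; index-sound to tightBlock-tight;
                index-complete to tightBlock-complete)

    looseOf : Fin #tightBlocks → Fin (suc n)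
    looseOf l = proj₁ (TightBlock⇒loose (tightBlock-tight l))

    looseOf-loose : ∀ l → Loose (tightBlock l) (looseOf l)
    looseOf-loose l = proj₂ (TightBlock⇒loose (tightBlock-tight l))

    Listed : Point (suc n) → Set
    Listed x = (x ≈ₚ V ns b 0)
      ⊎ (x ≈ₚ V ns b (suc n))
      ⊎ (Σ ℕ λ m → (1 ℕ.≤ m) × (m ℕ.≤ n) × (∀ l → m ≢ idx (looseOf l)) × (x ≈ₚ V ns b m))
      ⊎ (Σ (Fin #tightBlocks) λ l → x ≈ₚ V ns b (suc n ℕ.+ suc (toℕ (tightBlock l))))

    V-last≡e-last : V ns b (suc n) ≡ e last
    V-last≡e-last = cong (V ns b) (sym idx-last)

    unlisted⇒tight : ∀ {k} → (∀ l → k ≢ looseOf l) → Tight k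
    unlisted⇒tight {k} k-unlisted = decidable-stable (a k ℚ.≟ c) λ k-loose →
      let k≢last : k ≢ last
          k≢last k≡last = k-loose (subst Tight (sym k≡last) last-tight)
          i , k∈i = ≢last⇒InBlock k≢last
          i-tight = decidable-stable (a · blk i ℚ.≟ c) λ i-loose → k-loose (¬TightBlock⇒tight i-loose k∈i)
          l , tightBlock-l≡i = tightBlock-complete i-tight
      in k-unlisted l (loose-unique (k∈i , k-loose)
                                    (subst (λ i → Loose i (looseOf l)) tightBlock-l≡i (looseOf-loose l)))

    unit⇒vertex : ∀ {k} → Tight k → ∀ {x} → x ≈ₚ e k → IsVertex (InConv Δδ) x
    unit⇒vertex {k} k-tight x≈ek = by-cases (k Fin.≟ last)
      where
      Gk : Generator (suc (toℕ k))
      Gk = inj₂ (trans (·-e a k) k-tight)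
      by-cases : Dec (k ≡ last) → IsVertex (InConv Δδ) _
      by-cases (yes refl) = separated⇒vertex (VertexIndex⇒< (unit-index last)) Gk U U-separates x≈ek
      by-cases (no k≢last) = separated⇒vertex (VertexIndex⇒< (unit-index k)) Gk (e k) (e-separates k≢last) x≈ek

    listed⇒vertex : ∀ {x} → Listed x → IsVertex (InConv Δδ) x
    listed⇒vertex (inj₁ x≈0) = separated⇒vertex ℕ.z<s (inj₁ refl) (λ k → - a k) origin-separates x≈0
    listed⇒vertex {x} (inj₂ (inj₁ x≈V)) = unit⇒vertex last-tight (subst (x ≈ₚ_) V-last≡e-last x≈V)
    listed⇒vertex {x} (inj₂ (inj₂ (inj₁ (suc m , _ , m<n , m-unlisted , x≈V)))) =
      unit⇒vertex (unlisted⇒tight k-unlisted) (subst (x ≈ₚ_) V≡ek x≈V)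
      where
      m<1+n = ℕ.m<n⇒m<1+n m<n
      k = Fin.fromℕ< m<1+n
      toℕk≡m = Fin.toℕ-fromℕ< m<1+n
      V≡ek : V ns b (suc m) ≡ e k
      V≡ek = cong (λ t → V ns b (suc t)) (sym toℕk≡m)
      k-unlisted : ∀ l → k ≢ looseOf l
      k-unlisted l k≡L = m-unlisted l (trans (cong suc (sym toℕk≡m)) (cong idx k≡L))
    listed⇒vertex (inj₂ (inj₂ (inj₂ (l , x≈blk)))) =
      separated⇒vertex (VertexIndex⇒< (block-index (tightBlock l))) (inj₂ (tightBlock-tight l))
                       (λ k → - e (looseOf l) k) (blk-separates (looseOf-loose l)) x≈blk

    generator⇒listed : ∀ {m} → VertexIndex m → Generator m → ∀ {x} → x ≈ₚ V ns b m → Listed x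
    generator⇒listed origin-index _ x≈0 = inj₁ x≈0
    generator⇒listed (unit-index k) Gk {x} x≈ek = by-cases (k Fin.≟ last)
      where
      by-cases : Dec (k ≡ last) → Listed x
      by-cases (yes refl) = inj₂ (inj₁ (subst (x ≈ₚ_) (sym V-last≡e-last) x≈ek))
      by-cases (no k≢last) =
        inj₂ (inj₂ (inj₁ (suc (toℕ k) , ℕ.s≤s ℕ.z≤n , ≢last⇒toℕ<n k≢last , k-unlisted , x≈ek)))
        where
        k-unlisted : ∀ l → idx k ≢ idx (looseOf l)
        k-unlisted l k≡L = proj₂ (looseOf-loose l) (subst Tight (idx-injective k≡L) (unit-generator⇒tight Gk))
    generator⇒listed (block-index i) Gi {x} x≈blk =
      let l , tightBlock-l≡i = tightBlock-complete (block-generator⇒tight Gi)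
      in inj₂ (inj₂ (inj₂ (l , subst (λ i → x ≈ₚ blk i) (sym tightBlock-l≡i) x≈blk)))

    vertex⇒listed : ∀ {x} → IsVertex (InConv Δδ) x → Listed x
    vertex⇒listed x-vertex =
      let m , Gm , x≈Vm = IsVertex⇒generator x-vertex
      in generator⇒listed (vertexIndex (Fin.toℕ<n m)) Gm x≈Vm

    looseOf-bounds : ∀ l → N ns (toℕ (tightBlock l)) ℕ.+ 1 ℕ.≤ idx (looseOf l)
                         × idx (looseOf l) ℕ.≤ N ns (suc (toℕ (tightBlock l)))
    looseOf-bounds l =
      let lo , hi = proj₁ (looseOf-loose l) in subst (ℕ._≤ idx (looseOf l)) (ℕ.+-comm 1 _) lo , hi

open import Data.Nat using (_+_; _≤_)

proposition3p3 :
  (r : ℕ) → 1 ≤ r →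
  (ns : Fin r → ℕ) → (∀ i → 1 ≤ ns i) →
  (b : Fin (N ns r) → ℕ) → (∀ l → 1 ≤ b l) →
  (a : Point (suc (N ns r))) (c : ℚ) →
  Codim1Face (InΔ ns b) a c →
  ¬ Face (InΔ ns b) a c origin →
  Σ ℕ λ k → k ≤ r ×
  Σ (Fin k → Fin r) λ j → Injective _≡_ _≡_ j ×
  Σ (Fin k → ℕ) λ i →
    (∀ l → (N ns (toℕ (j l)) + 1 ≤ i l) × (i l ≤ N ns (suc (toℕ (j l))))) ×
    (∀ x →
      ((IsVertex (InConv (λ y → y ≈ₚ origin ⊎ Face (InΔ ns b) a c y)) x →
        (x ≈ₚ V ns b 0)
        ⊎ (x ≈ₚ V ns b (suc (N ns r)))
        ⊎ (Σ ℕ λ m → (1 ≤ m) × (m ≤ N ns r) × (∀ l → m ≢ i l) × (x ≈ₚ V ns b m))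
        ⊎ (Σ (Fin k) λ l → x ≈ₚ V ns b (suc (N ns r) + suc (toℕ (j l)))))
      ×
      ((x ≈ₚ V ns b 0)
        ⊎ (x ≈ₚ V ns b (suc (N ns r)))
        ⊎ (Σ ℕ λ m → (1 ≤ m) × (m ≤ N ns r) × (∀ l → m ≢ i l) × (x ≈ₚ V ns b m))
        ⊎ (Σ (Fin k) λ l → x ≈ₚ V ns b (suc (N ns r) + suc (toℕ (j l))))
       → IsVertex (InConv (λ y → y ≈ₚ origin ⊎ Face (InΔ ns b) a c y)) x)))
proposition3p3 r _ ns ns≥1 b b≥1 a c δ-codim1 0∉δ =
  #tightBlocks , size≤ , tightBlock , index-injective , idx ∘ looseOf , looseOf-bounds ,
  λ x → vertex⇒listed {x} , listed⇒vertex {x}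
  where open Facet ns ns≥1 b b≥1 a c δ-codim1 0∉δ
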